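{- For every bipartite graph $H$ of diameter three and girth six which is not isomorphic to any pseudo sphere graph $S_t$, $\delta'(H)=\delta_H$.
   Context: All graphs are finite and simple; $d_H(x,y)$ is the distance in $H$. $\delta_H$ denotes the minimum degree of $H$. The center $C(H)$ is the set of vertices of $H$ of eccentricity equal to the radius of $H$. For $a\in V(H)$, $N_H(a)$ is the set of neighbours of $a$ and $N^{(2)}_H(a)=\{w\in V(H): d_H(w,a)=2\}$. A set $A$ dominates a set $B$, written $A\succ B$, if every vertex of $B\setminus A$ is adjacent to some vertex of $A$. For $x\in C(H)$ let $\beta(x)=\min\{|A|: A\subseteq N_H(x),\ A\succ N_H^{(2)}(x)\}$, and $\delta'(H)=\min_{x\in C(H)}\beta(x)$. For $t\ge 3$, the pseudo sphere graph (near pencil) $S_t$ is obtained by taking $t-1$ disjoint paths of order $4$, identifying one end vertex of each path into a single vertex $a$ and the other end vertices into a single vertex $b$. -}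

module Defs where

open import Data.Nat using (ℕ; zero; suc; _≤_; _<_)
open import Data.Fin using (Fin; zero; suc; inject₁; fromℕ)
open import Data.Fin.Subset using (Subset; _∈_; _∉_; _⊆_; ∣_∣)
open import Data.Bool using (Bool; true; false)
open import Data.Vec using (tabulate)
open import Data.Product using (Σ; ∃; _×_; _,_)
open import Data.Empty using (⊥)
open import Relation.Nullary using (¬_)
open import Relation.Binary.PropositionalEquality using (_≡_; _≢_)
open import Function.Definitions using (Injective)
open import Function.Bundles using (Bijection; _⇔_; _⤖_)
import Data.Nat

record Graph : Set where
  field
    n      : ℕ
    adj    : Fin n → Fin n → Bool
    sym    : ∀ x y → adj x y ≡ adj y x
    irrefl : ∀ x → adj x x ≡ false

open Graph public

V : Graph → Set
V G = Fin (n G)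

Adj : (G : Graph) → V G → V G → Set
Adj G x y = adj G x y ≡ true

data Walk (G : Graph) : V G → V G → ℕ → Set where
  here : ∀ {x} → Walk G x x 0
  step : ∀ {x z y k} → Adj G x z → Walk G z y k → Walk G x y (suc k)

Dist : (G : Graph) → V G → V G → ℕ → Set
Dist G x y k = Walk G x y k × (∀ j → j < k → ¬ Walk G x y j)

Ecc : (G : Graph) → V G → ℕ → Set
Ecc G x e = (∀ y → ∃ λ k → Dist G x y k × k ≤ e) × (∃ λ y → Dist G x y e)

Diameter : Graph → ℕ → Set
Diameter G D = (∀ x y → ∃ λ k → Dist G x y k × k ≤ D)
             × (∃ λ x → ∃ λ y → Dist G x y D)

InCenter : (G : Graph) → V G → Set
InCenter G x = ∃ λ e → Ecc G x e × (∀ y e' → Ecc G y e' → e ≤ e')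

-- A cycle of length suc m (≥ 3): distinct vertices c 0,…,c m, consecutive adjacent, c m adjacent c 0
HasCycle : Graph → ℕ → Set
HasCycle G zero = ⊥
HasCycle G (suc m) = 2 ≤ m × Σ (Fin (suc m) → V G) λ c →
  Injective _≡_ _≡_ c × (∀ (i : Fin m) → Adj G (c (inject₁ i)) (c (suc i)))
  × Adj G (c (fromℕ m)) (c zero)

Girth : Graph → ℕ → Set
Girth G g = HasCycle G g × (∀ k → k < g → ¬ HasCycle G k)

Bipartite : Graph → Set
Bipartite G = Σ (V G → Bool) λ f → ∀ x y → Adj G x y → f x ≢ f y

Nbhd : (G : Graph) → V G → Subset (n G)
Nbhd G x = tabulate (λ y → adj G x y)

degree : (G : Graph) → V G → ℕ
degree G x = ∣ Nbhd G x ∣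

MinDegree : Graph → ℕ → Set
MinDegree G d = (∃ λ x → degree G x ≡ d) × (∀ x → d ≤ degree G x)

InN2 : (G : Graph) → V G → V G → Set
InN2 G x w = Dist G w x 2

DominatesN2 : (G : Graph) → V G → Subset (n G) → Set
DominatesN2 G x A = ∀ w → InN2 G x w → w ∉ A → ∃ λ a → a ∈ A × Adj G a w

Admissible : (G : Graph) → V G → Subset (n G) → Set
Admissible G x A = A ⊆ Nbhd G x × DominatesN2 G x A

Beta : (G : Graph) → V G → ℕ → Set
Beta G x b = (∃ λ A → Admissible G x A × ∣ A ∣ ≡ b)
           × (∀ A → Admissible G x A → b ≤ ∣ A ∣)

DeltaPrime : Graph → ℕ → Set
DeltaPrime G d = (∃ λ x → InCenter G x × Beta G x d)
               × (∀ x b → InCenter G x → Beta G x b → d ≤ b)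

-- Pseudo sphere graph S_t with m = t - 1 paths a - l i - r i - b
data SV (m : ℕ) : Set where
  sa sb : SV m
  sl sr : Fin m → SV m

data SAdj {m : ℕ} : SV m → SV m → Set where
  a-l : ∀ i → SAdj sa (sl i)
  l-a : ∀ i → SAdj (sl i) sa
  l-r : ∀ i → SAdj (sl i) (sr i)
  r-l : ∀ i → SAdj (sr i) (sl i)
  r-b : ∀ i → SAdj (sr i) sb
  b-r : ∀ i → SAdj sb (sr i)

IsoPseudoSphere : Graph → ℕ → Set
IsoPseudoSphere G t = Σ (V G ⤖ SV (t Data.Nat.∸ 1)) λ f →
  ∀ x y → (Adj G x y ⇔ SAdj (Bijection.to f x) (Bijection.to f y))

module Submission where

open import Defs hiding (sym)
open import Data.Nat using (zero; suc; _≤_; s≤s; z≤n)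
open import Data.Nat.Properties
  using (≤-trans; ≤-pred; ≤∧≢⇒<; ≰⇒>; _≤?_; ≤-totalOrder)
  renaming (_≟_ to _≟ℕ_)
open import Data.Fin using (Fin; zero; suc; inject₁; #_; _≟_)
open import Data.Fin.Properties using (any?)
open import Data.Fin.Subset using (_∈_; _⊆_; ∣_∣)
open import Data.Fin.Subset.Properties using (p⊆q⇒∣p∣≤∣q∣)
open import Data.Bool using (Bool; not; true)
open import Data.Bool.Properties using (¬-not; not-involutive) renaming (_≟_ to _≟𝔹_)
open import Data.List using (allFin)
open import Data.List.Membership.Propositional.Properties using (∈-allFin)
import Data.List.Relation.Unary.All as All
open import Data.List.Extrema ≤-totalOrder using (argmin; f[argmin]≤f[xs])
open import Data.Vec.Properties using (lookup∘tabulate; []=⇒lookup; lookup⇒[]=)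
open import Data.Product using (Σ; ∃; _×_; _,_; proj₁; proj₂)
open import Data.Empty using (⊥; ⊥-elim)
open import Relation.Nullary using (¬_; Dec; yes; no)
open import Relation.Nullary.Decidable using (_×-dec_; ¬?)
open import Relation.Binary.PropositionalEquality
  using (_≡_; _≢_; refl; sym; trans; cong; subst; ≢-sym)

-- In a bipartite graph without 4-cycles a vertex within distance two of
-- every vertex is impossible once a 6-cycle exists: the three hexagon
-- vertices of the colour opposite to it would all be its neighbours, closing
-- a 4-cycle.  Hence, with diameter 3, every vertex has eccentricity 3 and lies
-- in the centre, and every neighbour y of x has a second neighbour w, which
-- lies in N²(x).  A dominating set A ⊆ N(x) must reach w, and the only
-- neighbour of w in N(x) is y, so A = N(x) and β(x) = deg x.  Minimising over
-- the centre, i.e. over all vertices, gives δ' = δ.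

module _ (G : Graph) where

  Adj⇒≢ : ∀ {x y} → Adj G x y → x ≢ y
  Adj⇒≢ {x} xy refl with trans (sym (irrefl G x)) xy
  ... | ()

  Adj-sym : ∀ {x y} → Adj G x y → Adj G y x
  Adj-sym {x} {y} xy = trans (Graph.sym G y x) xy

  ∈Nbhd⇒Adj : ∀ {x y} → y ∈ Nbhd G x → Adj G x y
  ∈Nbhd⇒Adj {x} {y} y∈N = trans (sym (lookup∘tabulate (adj G x) y)) ([]=⇒lookup y∈N)

  Adj⇒∈Nbhd : ∀ {x y} → Adj G x y → y ∈ Nbhd G x
  Adj⇒∈Nbhd {x} {y} xy = lookup⇒[]= y (Nbhd G x) (trans (lookup∘tabulate (adj G x) y) xy)

  Nbhd-admissible : ∀ x → Admissible G x (Nbhd G x)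
  Nbhd-admissible x = (λ y∈N → y∈N) , λ where
    w (step wu (step ux here) , _) _ → _ , Adj⇒∈Nbhd (Adj-sym ux) , Adj-sym wu

  InN2⇒¬Adj : ∀ {x w} → InN2 G x w → ¬ Adj G x w
  InN2⇒¬Adj (_ , shortest) xw = shortest 1 (s≤s (s≤s z≤n)) (step (Adj-sym xw) here)

  square⇒HasCycle4 : ∀ {a b c d} → Adj G a b → Adj G b c → Adj G c d → Adj G d a
                   → a ≢ c → b ≢ d → HasCycle G 4
  square⇒HasCycle4 {a} {b} {c} {d} ab bc cd da a≢c b≢d =
    s≤s (s≤s z≤n) , cycle , injective , consecutive , da
    where
    cycle : Fin 4 → V G
    cycle zero                   = a
    cycle (suc zero)             = b
    cycle (suc (suc zero))       = c
    cycle (suc (suc (suc zero))) = d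

    distinct : ∀ i j → i ≢ j → cycle i ≢ cycle j
    distinct zero                   zero                   i≢i = ⊥-elim (i≢i refl)
    distinct zero                   (suc zero)             _   = Adj⇒≢ ab
    distinct zero                   (suc (suc zero))       _   = a≢c
    distinct zero                   (suc (suc (suc zero))) _   = ≢-sym (Adj⇒≢ da)
    distinct (suc zero)             zero                   _   = ≢-sym (Adj⇒≢ ab)
    distinct (suc zero)             (suc zero)             i≢i = ⊥-elim (i≢i refl)
    distinct (suc zero)             (suc (suc zero))       _   = Adj⇒≢ bc
    distinct (suc zero)             (suc (suc (suc zero))) _   = b≢d
    distinct (suc (suc zero))       zero                   _   = ≢-sym a≢c
    distinct (suc (suc zero))       (suc zero)             _   = ≢-sym (Adj⇒≢ bc)
    distinct (suc (suc zero))       (suc (suc zero))       i≢i = ⊥-elim (i≢i refl)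
    distinct (suc (suc zero))       (suc (suc (suc zero))) _   = Adj⇒≢ cd
    distinct (suc (suc (suc zero))) zero                   _   = Adj⇒≢ da
    distinct (suc (suc (suc zero))) (suc zero)             _   = ≢-sym b≢d
    distinct (suc (suc (suc zero))) (suc (suc zero))       _   = ≢-sym (Adj⇒≢ cd)
    distinct (suc (suc (suc zero))) (suc (suc (suc zero))) i≢i = ⊥-elim (i≢i refl)

    injective : ∀ {i j} → cycle i ≡ cycle j → i ≡ j
    injective {i} {j} eq with i ≟ j
    ... | yes i≡j = i≡j
    ... | no  i≢j = ⊥-elim (distinct i j i≢j eq)

    consecutive : ∀ (i : Fin 3) → Adj G (cycle (inject₁ i)) (cycle (suc i))
    consecutive zero             = ab
    consecutive (suc zero)       = bc
    consecutive (suc (suc zero)) = cd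

  minimumDegreeVertex : V G → Σ (V G) λ x → ∀ y → degree G x ≤ degree G y
  minimumDegreeVertex x₁ =
    argmin (degree G) x₁ (allFin _) ,
    λ y → All.lookup (f[argmin]≤f[xs] {f = degree G} x₁ (allFin _)) (∈-allFin y)

module BipartiteSquareFree
  (H : Graph) (col : V H → Bool) (proper : ∀ x y → Adj H x y → col x ≢ col y)
  (squareFree : ¬ HasCycle H 4) where

  colour-flip : ∀ {a b} → Adj H a b → col b ≡ not (col a)
  colour-flip ab = ¬-not (≢-sym (proper _ _ ab))

  colour-two-step : ∀ {a b c} → Adj H a b → Adj H b c → col a ≡ col c
  colour-two-step {a} ab bc =
    sym (trans (colour-flip bc) (trans (cong not (colour-flip ab)) (not-involutive (col a))))

  noSquare : ∀ {a b c d} → Adj H a b → Adj H b c → Adj H c d → Adj H d a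
           → a ≢ c → b ≢ d → ⊥
  noSquare ab bc cd da a≢c b≢d = squareFree (square⇒HasCycle4 H ab bc cd da a≢c b≢d)

  oppositeColour⇒Adj : ∀ {x z k} → Walk H x z k → k ≤ 2 → col z ≢ col x → Adj H x z
  oppositeColour⇒Adj here                          _ z≢x = ⊥-elim (z≢x refl)
  oppositeColour⇒Adj (step xz here)                _ _   = xz
  oppositeColour⇒Adj (step xu (step uz here))      _ z≢x = ⊥-elim (z≢x (sym (colour-two-step xu uz)))
  oppositeColour⇒Adj (step _ (step _ (step _ _))) (s≤s (s≤s ())) _

  ¬Adj-alternate-on-path : ∀ {x p q r s t}
    → Adj H p q → Adj H q r → Adj H r s → Adj H s t → p ≢ r → q ≢ s → r ≢ t
    → Adj H x p → Adj H x r → Adj H x t → ⊥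
  ¬Adj-alternate-on-path {x} {q = q} pq qr rs st p≢r q≢s r≢t xp xr xt with x ≟ q
  ... | no  x≢q  = noSquare xp pq qr (Adj-sym H xr) x≢q p≢r
  ... | yes refl = noSquare qr rs st (Adj-sym H xt) q≢s r≢t

  WithinTwo : V H → Set
  WithinTwo x = ∀ z → ∃ λ k → k ≤ 2 × Walk H x z k

  WithinTwo-oppositeColour⇒Adj : ∀ {x z} → WithinTwo x → col z ≢ col x → Adj H x z
  WithinTwo-oppositeColour⇒Adj {z = z} near z≢x =
    let (k , k≤2 , walk) = near z in oppositeColour⇒Adj walk k≤2 z≢x

  path⇒¬WithinTwo : ∀ {x p q r s t}
    → Adj H p q → Adj H q r → Adj H r s → Adj H s t → p ≢ r → q ≢ s → r ≢ t
    → col p ≢ col x → ¬ WithinTwo x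
  path⇒¬WithinTwo {x} {p} {q} {r} {s} {t} pq qr rs st p≢r q≢s r≢t p≢x near =
    ¬Adj-alternate-on-path pq qr rs st p≢r q≢s r≢t (toward p≢x) (toward r≢x) (toward t≢x)
    where
    toward : ∀ {z} → col z ≢ col x → Adj H x z
    toward = WithinTwo-oppositeColour⇒Adj near
    r≢x : col r ≢ col x
    r≢x r≡x = p≢x (trans (colour-two-step pq qr) r≡x)
    t≢x : col t ≢ col x
    t≢x t≡x = r≢x (trans (colour-two-step rs st) t≡x)

  hexagon⇒¬WithinTwo : HasCycle H 6 → ∀ x → ¬ WithinTwo x
  hexagon⇒¬WithinTwo (_ , c , injective , edge , _) x = byColourOf-c₀ (col (c (# 0)) ≟𝔹 col x)
    where
    distinct : ∀ {i j} → i ≢ j → c i ≢ c j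
    distinct i≢j eq = i≢j (injective eq)

    byColourOf-c₀ : Dec (col (c (# 0)) ≡ col x) → ¬ WithinTwo x
    byColourOf-c₀ (no c₀≢x) =
      path⇒¬WithinTwo (edge (# 0)) (edge (# 1)) (edge (# 2)) (edge (# 3))
        (distinct λ ()) (distinct λ ()) (distinct λ ()) c₀≢x
    byColourOf-c₀ (yes c₀≡x) =
      path⇒¬WithinTwo (edge (# 1)) (edge (# 2)) (edge (# 3)) (edge (# 4))
        (distinct λ ()) (distinct λ ()) (distinct λ ())
        λ c₁≡x → proper _ _ (edge (# 0)) (trans c₀≡x (sym c₁≡x))

  InN2-intro : ∀ {x y w} → Adj H x y → Adj H y w → w ≢ x → InN2 H x w
  InN2-intro {x} {y} {w} xy yw w≢x = step (Adj-sym H yw) (step (Adj-sym H xy) here) , λ where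
    zero             _                     here            → w≢x refl
    (suc zero)       _                     (step wx here)  → proper w x wx (sym (colour-two-step xy yw))
    (suc (suc _))    (s≤s (s≤s ()))        _

  3≤eccentricity : HasCycle H 6 → ∀ {y e} → Ecc H y e → 3 ≤ e
  3≤eccentricity hexagon {y} {e} (reach , _) with 3 ≤? e
  ... | yes 3≤e = 3≤e
  ... | no  3≰e = ⊥-elim (hexagon⇒¬WithinTwo hexagon y near)
    where
    near : WithinTwo y
    near z = let (k , (walk , _) , k≤e) = reach z in k , ≤-trans k≤e (≤-pred (≰⇒> 3≰e)) , walk

  module Diameter3 (hexagon : HasCycle H 6) (diam : ∀ x y → ∃ λ k → Dist H x y k × k ≤ 3) where

    secondNeighbour : ∀ {x y} → Adj H x y → ∃ λ w → Adj H y w × w ≢ x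
    secondNeighbour {x} {y} xy with any? (λ w → (adj H y w ≟𝔹 true) ×-dec ¬? (w ≟ x))
    ... | yes found = found
    ... | no  none  = ⊥-elim (hexagon⇒¬WithinTwo hexagon x near)
      where
      -- x is the only neighbour of y, so walks of length ≤ 3 from y pass through x.
      near : WithinTwo x
      near z with diam y z
      ... | _     , (here , _)                , _       = 1 , s≤s z≤n , step xy here
      ... | suc k , (step {z = u} yu walk , _) , s≤s k≤2 with u ≟ x
      ...   | yes refl = k , k≤2 , walk
      ...   | no  u≢x  = ⊥-elim (none (u , yu , u≢x))

    neighbour∈admissible : ∀ {x y A} → Admissible H x A → Adj H x y → y ∈ A
    neighbour∈admissible {x} {y} {A} (A⊆N , dominates) xy with secondNeighbour xy
    ... | w , yw , w≢x
      with dominates w (InN2-intro xy yw w≢x)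
                     (λ w∈A → InN2⇒¬Adj H (InN2-intro xy yw w≢x) (∈Nbhd⇒Adj H (A⊆N w∈A)))
    ... | a , a∈A , aw with a ≟ y
    ...   | yes refl = a∈A
    ...   | no  a≢y  = ⊥-elim (noSquare xy yw (Adj-sym H aw) (Adj-sym H (∈Nbhd⇒Adj H (A⊆N a∈A)))
                                         (≢-sym w≢x) (≢-sym a≢y))

    degree≤∣admissible∣ : ∀ {x A} → Admissible H x A → degree H x ≤ ∣ A ∣
    degree≤∣admissible∣ adm = p⊆q⇒∣p∣≤∣q∣ λ y∈N → neighbour∈admissible adm (∈Nbhd⇒Adj H y∈N)

    Beta-degree : ∀ x → Beta H x (degree H x)
    Beta-degree x = (Nbhd H x , Nbhd-admissible H x , refl) , λ _ → degree≤∣admissible∣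

    vertexAtDistance3 : ∀ x → ∃ λ z → Dist H x z 3
    vertexAtDistance3 x with any? (λ z → proj₁ (diam x z) ≟ℕ 3)
    ... | yes (z , k≡3) = z , subst (Dist H x z) k≡3 (proj₁ (proj₂ (diam x z)))
    ... | no  none      = ⊥-elim (hexagon⇒¬WithinTwo hexagon x near)
      where
      near : WithinTwo x
      near z = let (k , (walk , _) , k≤3) = diam x z
               in k , ≤-pred (≤∧≢⇒< k≤3 λ k≡3 → none (z , k≡3)) , walk

    central : ∀ x → InCenter H x
    central x = 3 , (diam x , vertexAtDistance3 x) , λ _ _ → 3≤eccentricity hexagon

mainTheorem16 : (H : Graph) → Bipartite H → Diameter H 3 → Girth H 6
    → (∀ t → 3 ≤ t → ¬ IsoPseudoSphere H t)
    → ∃ λ d → DeltaPrime H d × MinDegree H d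
mainTheorem16 H (col , proper) (diam , x₁ , _) (hexagon , noShorterCycle) _ =
  degree H x₀ , ((x₀ , central x₀ , Beta-degree x₀) , δ≤β) , (x₀ , refl) , minimal
  where
  open BipartiteSquareFree H col proper (noShorterCycle 4 (s≤s (s≤s (s≤s (s≤s (s≤s z≤n))))))
  open Diameter3 hexagon diam

  x₀ : V H
  x₀ = proj₁ (minimumDegreeVertex H x₁)

  minimal : ∀ y → degree H x₀ ≤ degree H y
  minimal = proj₂ (minimumDegreeVertex H x₁)

  δ≤β : ∀ x b → InCenter H x → Beta H x b → degree H x₀ ≤ b
  δ≤β x _ _ ((_ , admissible , refl) , _) = ≤-trans (minimal x) (degree≤∣admissible∣ admissible)
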